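{- For integers $1<k\leq n$, $\sum_{i=k}^n\frac{1}{F_{2i}}<\frac{1}{F_{2k-2}}+\frac{1}{F_{2n+2}}-\frac{1}{F_{2k}}-\frac{1}{F_{2n}}$.
   Context: $F_n$ denotes the Fibonacci numbers: $F_0=0$, $F_1=1$, $F_n=F_{n-1}+F_{n-2}$ for $n>1$. -}

module Defs where

open import Data.Nat using (ℕ; zero; suc; _+_)
open import Data.Integer using (+_)
open import Data.Rational using (ℚ; 0ℚ; _/_) renaming (_+_ to _+ℚ_)

F : ℕ → ℕ
F zero = zero
F (suc zero) = suc zero
F (suc (suc n)) = F (suc n) + F n

-- 1 / F m as a rational number.  F m = 0 only for m = 0; the value at
-- m = 0 is a dummy (0) and is never used by the statement below.
invF : ℕ → ℚ
invF m with F m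
... | zero = 0ℚ
... | suc d = (+ 1) / suc d

sumFrom : ℕ → ℕ → (ℕ → ℚ) → ℚ
sumFrom k zero f = 0ℚ
sumFrom k (suc len) f = f k +ℚ sumFrom (suc k) len f

-- Write aᵢ = 1/F₂ᵢ.  Since F₂ᵢ₋₂ + F₂ᵢ₊₂ = 3F₂ᵢ and, by Cassini's identity at even
-- index, F₂ᵢ₋₂F₂ᵢ₊₂ = F₂ᵢ² − 1, we get aᵢ₋₁ + aᵢ₊₁ = 3F₂ᵢ/(F₂ᵢ² − 1) > 3aᵢ for i ≥ 2.
-- In terms of the drops dᵢ = aᵢ₋₁ − aᵢ this reads aᵢ < dᵢ − dᵢ₊₁, so the sum over
-- k ≤ i ≤ n telescopes to less than dₖ − dₙ₊₁, which is the right-hand side.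
module Submission where

open import Defs
open import Data.Nat using (ℕ; _*_; _∸_; _<_; _≤_; suc) renaming (_+_ to _+ℕ_)
open import Data.Rational using (_+_; _-_) renaming (_<_ to _<ℚ_)

open import Data.Nat using (zero; z<s; s≤s)
open import Data.Nat.Properties
  using (≤-refl; ≤-trans; <⇒≤; +-comm; +-suc; *-suc; *-distribˡ-+; *-distribˡ-∸; m∸n+n≡m; m<m+n;
         *-monoʳ-<)
import Data.Nat.Properties as ℕ
open import Data.Nat.Tactic.RingSolver using (solve-∀; solve)
open import Data.Integer using (+_; +<+)
open import Data.Rational using (ℚ; _/_; -_; toℚᵘ)
import Data.Rational.Properties as ℚ
open import Data.Rational.Solver using (module +-*-Solver)
open import Data.Rational.Unnormalised using (mkℚᵘ; *<*)
  renaming (_+_ to _+ᵘ_; _<_ to _<ᵘ_; _≃_ to _≃ᵘ_)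
import Data.Rational.Unnormalised.Properties as ℚᵘ
open import Data.List using (_∷_; [])
open import Data.Product using (∃-syntax; _,_; map)
open import Relation.Binary.PropositionalEquality
  using (_≡_; refl; sym; trans; cong; cong₂; subst; subst₂; module ≡-Reasoning)

open +-*-Solver using (_:+_; _:-_; _:=_) renaming (solve to ℚ-solve)

[p-q]+[q-r]≡p-r : ∀ p q r → (p - q) + (q - r) ≡ p - r
[p-q]+[q-r]≡p-r = ℚ-solve 3 (λ p q r → (p :- q) :+ (q :- r) := p :- r) refl

[p-q]-[r-s]≡[[p+s]-q]-r : ∀ p q r s → (p - q) - (r - s) ≡ ((p + s) - q) - r
[p-q]-[r-s]≡[[p+s]-q]-r = ℚ-solve 4 (λ p q r s → (p :- q) :- (r :- s) := ((p :+ s) :- q) :- r) refl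

3·y<x+z⇒y<[x-y]-[y-z] : ∀ x y z → (y + y) + y <ℚ x + z → y <ℚ (x - y) - (y - z)
3·y<x+z⇒y<[x-y]-[y-z] x y z 3y<x+z =
  subst₂ _<ℚ_ (ℚ-solve 1 (λ y → ((y :+ y) :+ y) :- (y :+ y) := y) refl y)
              (ℚ-solve 3 (λ x y z → (x :+ z) :- (y :+ y) := (x :- y) :- (y :- z)) refl x y z)
              (ℚ.+-monoˡ-< (- (y + y)) 3y<x+z)

sumFrom-<-telescope : ∀ {f g : ℕ → ℚ} k m → (∀ i → k ≤ i → f i <ℚ g i - g (suc i)) →
                      sumFrom k (suc m) f <ℚ g k - g (suc m +ℕ k)
sumFrom-<-telescope {f} k zero f<Δg = subst (_<ℚ _) (sym (ℚ.+-identityʳ (f k))) (f<Δg k ≤-refl)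
sumFrom-<-telescope {f} {g} k (suc m) f<Δg = begin-strict
    f k + sumFrom (suc k) (suc m) f
  <⟨ ℚ.+-mono-< (f<Δg k ≤-refl)
                 (sumFrom-<-telescope {g = g} (suc k) m (λ i k<i → f<Δg i (<⇒≤ k<i))) ⟩
    (g k - g (suc k)) + (g (suc k) - g (suc m +ℕ suc k))
  ≡⟨ [p-q]+[q-r]≡p-r (g k) (g (suc k)) (g (suc m +ℕ suc k)) ⟩
    g k - g (suc m +ℕ suc k)
  ≡⟨ cong (λ e → g k - g (suc e)) (+-suc m k) ⟩
    g k - g (suc (suc m) +ℕ k) ∎
  where open ℚ.≤-Reasoning

-- The cross-multiplied inequality behind *<*, with ℚᵘ's _+_ unfolded.
3/y<1/x+1/zᵘ : ∀ x y z → suc x +ℕ suc z ≡ 3 * suc y → suc x * suc z < suc y * suc y →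
  (mkℚᵘ (+ 1) y +ᵘ mkℚᵘ (+ 1) y) +ᵘ mkℚᵘ (+ 1) y <ᵘ mkℚᵘ (+ 1) x +ᵘ mkℚᵘ (+ 1) z
3/y<1/x+1/zᵘ x y z x+z≡3y xz<yy = *<* (+<+ (begin-strict
    ((1 * suc y +ℕ 1 * suc y) * suc y +ℕ 1 * (suc y * suc y)) * (suc x * suc z)
      ≡⟨ solve (x ∷ y ∷ z ∷ []) ⟩
    3 * (suc y * suc y) * (suc x * suc z)
      <⟨ *-monoʳ-< (3 * (suc y * suc y)) xz<yy ⟩
    3 * (suc y * suc y) * (suc y * suc y)
      ≡⟨ solve (y ∷ []) ⟩
    3 * suc y * (suc y * suc y * suc y)
      ≡⟨ cong (_* (suc y * suc y * suc y)) (sym x+z≡3y) ⟩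
    (suc x +ℕ suc z) * (suc y * suc y * suc y)
      ≡⟨ solve (x ∷ y ∷ z ∷ []) ⟩
    (1 * suc z +ℕ 1 * suc x) * ((suc y * suc y) * suc y) ∎))
  where open ℕ.≤-Reasoning

3/y<1/x+1/z : ∀ x y z → suc x +ℕ suc z ≡ 3 * suc y → suc x * suc z < suc y * suc y →
  ((+ 1 / suc y) + (+ 1 / suc y)) + (+ 1 / suc y) <ℚ (+ 1 / suc x) + (+ 1 / suc z)
3/y<1/x+1/z x y z x+z≡3y xz<yy = ℚ.toℚᵘ-cancel-< (begin-strict
    toℚᵘ ((1/suc y + 1/suc y) + 1/suc y)
  ≃⟨ ℚᵘ.≃-trans (ℚ.toℚᵘ-homo-+ (1/suc y + 1/suc y) (1/suc y))
                (ℚᵘ.+-cong (toℚᵘ-1/suc+1/suc y y) (toℚᵘ-1/suc y)) ⟩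
    (mkℚᵘ (+ 1) y +ᵘ mkℚᵘ (+ 1) y) +ᵘ mkℚᵘ (+ 1) y
  <⟨ 3/y<1/x+1/zᵘ x y z x+z≡3y xz<yy ⟩
    mkℚᵘ (+ 1) x +ᵘ mkℚᵘ (+ 1) z
  ≃⟨ ℚᵘ.≃-sym (toℚᵘ-1/suc+1/suc x z) ⟩
    toℚᵘ (1/suc x + 1/suc z) ∎)
  where
  open ℚᵘ.≤-Reasoning
  1/suc : ℕ → ℚ
  1/suc d = + 1 / suc d
  toℚᵘ-1/suc : ∀ d → toℚᵘ (1/suc d) ≃ᵘ mkℚᵘ (+ 1) d
  toℚᵘ-1/suc d = ℚ.toℚᵘ-fromℚᵘ (mkℚᵘ (+ 1) d)
  toℚᵘ-1/suc+1/suc : ∀ d e → toℚᵘ (1/suc d + 1/suc e) ≃ᵘ mkℚᵘ (+ 1) d +ᵘ mkℚᵘ (+ 1) e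
  toℚᵘ-1/suc+1/suc d e =
    ℚᵘ.≃-trans (ℚ.toℚᵘ-homo-+ (1/suc d) (1/suc e)) (ℚᵘ.+-cong (toℚᵘ-1/suc d) (toℚᵘ-1/suc e))

F-suc-positive : ∀ n → ∃[ d ] F (suc n) ≡ suc d
F-suc-positive zero = 0 , refl
F-suc-positive (suc n) = map (_+ℕ F n) (cong (_+ℕ F n)) (F-suc-positive n)

F≡suc⇒invF≡1/suc : ∀ m {d} → F m ≡ suc d → invF m ≡ + 1 / suc d
F≡suc⇒invF≡1/suc m Fm≡1+d with F m
F≡suc⇒invF≡1/suc m refl | .(suc _) = refl

F[n]+F[4+n]≡3*F[2+n] : ∀ n → F n +ℕ F (4 +ℕ n) ≡ 3 * F (2 +ℕ n)
F[n]+F[4+n]≡3*F[2+n] n = identity (F n) (F (suc n))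
  where
  identity : ∀ a b → a +ℕ (((b +ℕ a) +ℕ b) +ℕ (b +ℕ a)) ≡ 3 * (b +ℕ a)
  identity = solve-∀

-- With a = F t and b = F (1 + t), each of the Cassini-type identities below
-- amounts to a * a + a * b + 1 = b * b.
Cassini : ℕ → Set
Cassini t = F t * F (2 +ℕ t) +ℕ 1 ≡ F (suc t) * F (suc t)

Cassini-2+ : ∀ t → Cassini t → Cassini (2 +ℕ t)
Cassini-2+ t = step (F t) (F (suc t))
  where
  step : ∀ a b → a * (b +ℕ a) +ℕ 1 ≡ b * b →
         (b +ℕ a) * (((b +ℕ a) +ℕ b) +ℕ (b +ℕ a)) +ℕ 1 ≡ ((b +ℕ a) +ℕ b) * ((b +ℕ a) +ℕ b)
  step a b h = begin
      (b +ℕ a) * (((b +ℕ a) +ℕ b) +ℕ (b +ℕ a)) +ℕ 1 ≡⟨ solve (a ∷ b ∷ []) ⟩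
      (a * (b +ℕ a) +ℕ 1) +ℕ (a +ℕ b) * (a +ℕ 3 * b) ≡⟨ cong (_+ℕ (a +ℕ b) * (a +ℕ 3 * b)) h ⟩
      b * b +ℕ (a +ℕ b) * (a +ℕ 3 * b)               ≡⟨ solve (a ∷ b ∷ []) ⟩
      ((b +ℕ a) +ℕ b) * ((b +ℕ a) +ℕ b)              ∎
    where open ≡-Reasoning

Cassini-even : ∀ j → Cassini (2 * j)
Cassini-even zero = refl
Cassini-even (suc j) = subst Cassini (sym (*-suc 2 j)) (Cassini-2+ (2 * j) (Cassini-even j))

Cassini⇒F[t]*F[4+t]+1≡F[2+t]*F[2+t] : ∀ t → Cassini t →
                                      F t * F (4 +ℕ t) +ℕ 1 ≡ F (2 +ℕ t) * F (2 +ℕ t)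
Cassini⇒F[t]*F[4+t]+1≡F[2+t]*F[2+t] t = catalan (F t) (F (suc t))
  where
  catalan : ∀ a b → a * (b +ℕ a) +ℕ 1 ≡ b * b →
            a * (((b +ℕ a) +ℕ b) +ℕ (b +ℕ a)) +ℕ 1 ≡ (b +ℕ a) * (b +ℕ a)
  catalan a b h = begin
      a * (((b +ℕ a) +ℕ b) +ℕ (b +ℕ a)) +ℕ 1 ≡⟨ solve (a ∷ b ∷ []) ⟩
      (a * (b +ℕ a) +ℕ 1) +ℕ a * (a +ℕ 2 * b) ≡⟨ cong (_+ℕ a * (a +ℕ 2 * b)) h ⟩
      b * b +ℕ a * (a +ℕ 2 * b)               ≡⟨ solve (a ∷ b ∷ []) ⟩
      (b +ℕ a) * (b +ℕ a)                     ∎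
    where open ≡-Reasoning

3·invF[2+t]<invF[t]+invF[4+t] : ∀ t → 0 < t → Cassini t →
  (invF (2 +ℕ t) + invF (2 +ℕ t)) + invF (2 +ℕ t) <ℚ invF t + invF (4 +ℕ t)
3·invF[2+t]<invF[t]+invF[4+t] (suc s) _ cassini
  with F-suc-positive s | F-suc-positive (2 +ℕ s) | F-suc-positive (4 +ℕ s)
... | x , Fx | y , Fy | z , Fz =
  subst₂ _<ℚ_ (cong (λ r → (r + r) + r) (sym (F≡suc⇒invF≡1/suc (3 +ℕ s) Fy)))
              (sym (cong₂ _+_ (F≡suc⇒invF≡1/suc (suc s) Fx) (F≡suc⇒invF≡1/suc (5 +ℕ s) Fz)))
              (3/y<1/x+1/z x y z x+z≡3y xz<yy)
  where
  open ℕ.≤-Reasoning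
  x+z≡3y : suc x +ℕ suc z ≡ 3 * suc y
  x+z≡3y = begin-equality
    suc x +ℕ suc z          ≡⟨ cong₂ _+ℕ_ Fx Fz ⟨
    F (suc s) +ℕ F (5 +ℕ s) ≡⟨ F[n]+F[4+n]≡3*F[2+n] (suc s) ⟩
    3 * F (3 +ℕ s)          ≡⟨ cong (3 *_) Fy ⟩
    3 * suc y               ∎
  xz<yy : suc x * suc z < suc y * suc y
  xz<yy = begin-strict
    suc x * suc z                ≡⟨ cong₂ _*_ Fx Fz ⟨
    F (suc s) * F (5 +ℕ s)       <⟨ m<m+n _ z<s ⟩
    F (suc s) * F (5 +ℕ s) +ℕ 1  ≡⟨ Cassini⇒F[t]*F[4+t]+1≡F[2+t]*F[2+t] (suc s) cassini ⟩
    F (3 +ℕ s) * F (3 +ℕ s)      ≡⟨ cong₂ _*_ Fy Fy ⟩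
    suc y * suc y                ∎

invFEven : ℕ → ℚ
invFEven i = invF (2 * i)

invFEven-+ : ∀ m i → invFEven (m +ℕ i) ≡ invF (2 * m +ℕ 2 * i)
invFEven-+ m i = cong invF (*-distribˡ-+ 2 m i)

3·invFEven[2+j]<invFEven[1+j]+invFEven[3+j] : ∀ j →
  (invFEven (2 +ℕ j) + invFEven (2 +ℕ j)) + invFEven (2 +ℕ j)
    <ℚ invFEven (1 +ℕ j) + invFEven (3 +ℕ j)
3·invFEven[2+j]<invFEven[1+j]+invFEven[3+j] j rewrite invFEven-+ 1 (suc j) | invFEven-+ 2 (suc j) =
  3·invF[2+t]<invF[t]+invF[4+t] (2 * suc j) z<s (Cassini-even (suc j))

invFEven-drop : ℕ → ℚ
invFEven-drop i = invFEven (i ∸ 1) - invFEven i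

invFEven<drop-drop : ∀ {i} → 2 ≤ i → invFEven i <ℚ invFEven-drop i - invFEven-drop (suc i)
invFEven<drop-drop {suc (suc j)} (s≤s (s≤s _)) =
  3·y<x+z⇒y<[x-y]-[y-z] (invFEven (1 +ℕ j)) (invFEven (2 +ℕ j)) (invFEven (3 +ℕ j))
                        (3·invFEven[2+j]<invFEven[1+j]+invFEven[3+j] j)

lemma9 : (k n : ℕ) → 1 < k → k ≤ n →
    sumFrom k (suc (n ∸ k)) (λ i → invF (2 * i))
      <ℚ (((invF (2 * k ∸ 2) + invF (2 * n +ℕ 2)) - invF (2 * k)) - invF (2 * n))
lemma9 k n 1<k k≤n = begin-strict
    sumFrom k (suc (n ∸ k)) invFEven
  <⟨ sumFrom-<-telescope {g = invFEven-drop} k (n ∸ k)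
       (λ i k≤i → invFEven<drop-drop (≤-trans 1<k k≤i)) ⟩
    invFEven-drop k - invFEven-drop (suc (n ∸ k +ℕ k))
  ≡⟨ cong (λ m → invFEven-drop k - invFEven-drop (suc m)) (m∸n+n≡m k≤n) ⟩
    invFEven-drop k - invFEven-drop (suc n)
  ≡⟨ cong₂ (λ p r → (p - invF (2 * k)) - (invF (2 * n) - r))
           (cong invF (*-distribˡ-∸ 2 k 1)) (cong invF (trans (*-suc 2 n) (+-comm 2 (2 * n)))) ⟩
    (invF (2 * k ∸ 2) - invF (2 * k)) - (invF (2 * n) - invF (2 * n +ℕ 2))
  ≡⟨ [p-q]-[r-s]≡[[p+s]-q]-r
       (invF (2 * k ∸ 2)) (invF (2 * k)) (invF (2 * n)) (invF (2 * n +ℕ 2)) ⟩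
    ((invF (2 * k ∸ 2) + invF (2 * n +ℕ 2)) - invF (2 * k)) - invF (2 * n) ∎
  where open ℚ.≤-Reasoning
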